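{- Let $A=\{1,4,9,\dots,n^2,\dots\}$ be the set of positive squares, so $a_n=n^2$ for $n\geqslant1$, and for $k\geqslant 1$ let $u(k)=s(\{1^2,2^2,\dots,k^2\})$. Let $f:\{1,2,\dots\}\to(0,\infty)$ be a function such that $u(k)/f(k)$ is unbounded. Let $B=\{b_1<b_2<\dots\}$ be an infinite subset of $\mathbb N$ enumerated in increasing order, and suppose that for every $k\geqslant 1$ and every $n\leqslant k$ we have $|b_n-n^2|\leqslant f(k)$. Then $s(B)=\infty$, i.e., $B$ is in the upper class.
   Context: For $X\subseteq \mathbb N=\{0,1,2,\dots\}$ and $n\in\mathbb N$, $r(X,n)$ denotes the number of ordered pairs $(x,y)\in X\times X$ with $x+y=n$, and $s(X)=\sup\{r(X,n): n\in\mathbb N\}\in\mathbb N\cup\{\infty\}$. A set $X$ is in the upper class if $s(X)=\infty$.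
   Formalization: The function f takes values in the positive rationals rather than in $(0,\infty)$. -}

module Defs where

open import Data.Nat using (ℕ; zero; suc; _+_; _*_; _∸_; _≤_; _<_; _⊔_; _≡ᵇ_; ∣_-_∣)
open import Data.Bool using (Bool; true; false; _∧_; _∨_)
open import Data.List using (List; []; _∷_; length; filterᵇ; map; foldr; upTo)
open import Data.Bool.ListAction using (any)
open import Data.List.Relation.Unary.All using (All)
open import Data.List.Relation.Unary.Unique.Propositional using (Unique)
open import Data.Product using (Σ; ∃; _×_; _,_)
open import Relation.Binary.PropositionalEquality using (_≡_)
open import Data.Integer using (+_)
open import Data.Rational using (ℚ; Positive; _÷_; _/_)
open import Data.Rational.Properties using (pos⇒nonZero)

DSet : Set
DSet = ℕ → Bool

r : DSet → ℕ → ℕ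
r X n = length (filterᵇ (λ x → X x ∧ X (n ∸ x)) (upTo (suc n)))

squaresUpTo : ℕ → DSet
squaresUpTo k x = any (λ j → (suc j * suc j) ≡ᵇ x) (upTo k)

-- u(k) = s({1²,…,k²}) = sup_n r(·,n).  Since r(·,n) = 0 for n > 2k²,
-- the supremum is the maximum over n ∈ {0,…,2k²}.
u : ℕ → ℕ
u k = foldr _⊔_ 0 (map (r (squaresUpTo k)) (upTo (suc (2 * (k * k)))))

ℕtoℚ : ℕ → ℚ
ℕtoℚ m = (+ m) / 1

ratio : (f : ℕ → ℚ) (k : ℕ) → Positive (f k) → ℚ
ratio f k pos = _÷_ (ℕtoℚ (u k)) (f k) {{pos⇒nonZero (f k) {{pos}}}}

-- "r(X,n) ≥ m": there are m distinct ordered pairs (x , y) ∈ X × X with x + y = n.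
-- Here X is an arbitrary (not necessarily decidable) subset of ℕ.
AtLeastReps : (ℕ → Set) → ℕ → ℕ → Set
AtLeastReps X n m =
  Σ (List (ℕ × ℕ)) λ L →
    Unique L × length L ≡ m ×
    All (λ { (x , y) → X x × X y × x + y ≡ n }) L

UpperClass : (ℕ → Set) → Set
UpperClass X = ∀ m → ∃ λ n → AtLeastReps X n m

-- The set B = {b₁ < b₂ < …} enumerated by b (indices from 1; b 0 is unused).
EnumSet : (ℕ → ℕ) → ℕ → Set
EnumSet b x = ∃ λ i → 1 ≤ i × b i ≡ x

{-# OPTIONS --safe #-}
-- To find m representations by B: choose k with u(k)/f(k) large and put F = ⌊f(k)⌋, so that
-- |b_i − i²| ≤ F for i ≤ k.  Take n with u(k) representations n = i² + j², 1 ≤ i, j ≤ k.  Each gives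
-- b_i + b_j ∈ [n − 2F, n + 2F], so by pigeonhole one of these 4F + 1 values has at least
-- u(k)/(4F + 1) ≥ u(k)/(5 f(k)) representations by B.  If F = 0 this bound is void, but then b_i = i²
-- for i ≤ k.  Since u(k)/f(k) is bounded on every finite range, k can be taken beyond
-- D = ∏_{j ≤ m+1} (2j² + 2j + 1), and D² = x² + y² for the m + 1 rescaled Pythagorean triples
-- (2j + 1, 2j² + 2j, 2j² + 2j + 1).
module Submission where

open import Defs
open import Data.Bool using (Bool; true; false; T; _∧_; if_then_else_)
open import Data.Bool.ListAction using (any)
open import Data.Bool.Properties using (T-∧)
open import Data.Integer as ℤ using (+[1+_])
open import Data.Integer.Properties using (pos-*; drop‿+≤+; drop‿+<+)
open import Data.List using (List; []; _∷_; length; map; filter; filterᵇ; take; applyUpTo; upTo)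
open import Data.List.Membership.Propositional.Properties using (∈-applyUpTo⁺; ∈-map⁻; foldr-selective)
open import Data.List.Properties using (length-map; length-take; length-applyUpTo)
open import Data.List.Relation.Binary.Sublist.Propositional.Properties using (filter-⊆; length-mono-≤)
import Data.List.Relation.Binary.Sublist.Propositional.Properties as Sublist
open import Data.List.Relation.Unary.All as All using (All; []; _∷_)
import Data.List.Relation.Unary.All.Properties as All
import Data.List.Relation.Unary.AllPairs.Properties as AllPairs
open import Data.List.Relation.Unary.Unique.Propositional using (Unique; []; _∷_)
import Data.List.Relation.Unary.Unique.Propositional.Properties as Unique
open import Data.Nat
open import Data.Nat.Properties
open import Data.Nat.DivMod using (_/_; m*n/n≡m; m/n*n≡m; m/n*n≤m; /-monoˡ-≤; m≥n⇒m/n>0)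
open import Data.Nat.Divisibility using (_∣_; ∣⇒≤)
open import Data.Nat.ListAction using (product)
open import Data.Nat.ListAction.Properties using (∈⇒∣product; product≢0)
open import Data.Nat.Tactic.RingSolver using (solve-∀)
open import Data.Product using (Σ; ∃; _×_; _,_; proj₁; proj₂; map₂)
open import Data.Rational using (ℚ; mkℚ; Positive; _÷_; ↥_; ↧ₙ_; toℚᵘ) renaming (_≤_ to _≤ℚ_; _<_ to _<ℚ_)
open import Data.Rational.Properties using (pos⇒nonZero; toℚᵘ-fromℚᵘ; toℚᵘ-mono-≤; toℚᵘ-mono-<; toℚᵘ-homo-*)
open import Data.Rational.Unnormalised using (mkℚᵘ; *≤*; *<*; *≡*) renaming (_≤_ to _≤ᵘ_; _<_ to _<ᵘ_; _≃_ to _≃ᵘ_)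
open import Data.Rational.Unnormalised.Properties using (≤-respˡ-≃; <-respˡ-≃; <-respʳ-≃; ≃-trans; *-congʳ)
open import Data.Sum using (inj₁; inj₂)
open import Function using (_∘_; Equivalence)
open import Relation.Binary.Definitions using (tri<; tri≈; tri>)
open import Relation.Binary.PropositionalEquality
open import Relation.Nullary using (yes; no; contradiction)
open import Relation.Nullary.Decidable using (T?)
open import Relation.Unary using (Decidable)
open import Relation.Unary.Properties using (∁?)

module _ {f : ℕ → ℕ} (f-increasing : ∀ i → 1 ≤ i → f i < f (suc i)) where

  increasing⇒strictlyMonotone : ∀ {i j} → 1 ≤ i → i < j → f i < f j
  increasing⇒strictlyMonotone {i} {suc j} 1≤i i<1+j with m<1+n⇒m<n∨m≡n i<1+j
  ... | inj₁ i<j  = <-trans (increasing⇒strictlyMonotone 1≤i i<j) (f-increasing j (≤-trans 1≤i (<⇒≤ i<j)))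
  ... | inj₂ refl = f-increasing i 1≤i

  increasing⇒injective : ∀ {i j} → 1 ≤ i → 1 ≤ j → f i ≡ f j → i ≡ j
  increasing⇒injective {i} {j} 1≤i 1≤j fi≡fj with <-cmp i j
  ... | tri< i<j _ _ = contradiction fi≡fj (<⇒≢ (increasing⇒strictlyMonotone 1≤i i<j))
  ... | tri≈ _ i≡j _ = i≡j
  ... | tri> _ _ j<i = contradiction fi≡fj (>⇒≢ (increasing⇒strictlyMonotone 1≤j j<i))

∣m+n-o+p∣≤∣m-o∣+∣n-p∣ : ∀ m n o p → ∣ m + n - o + p ∣ ≤ ∣ m - o ∣ + ∣ n - p ∣
∣m+n-o+p∣≤∣m-o∣+∣n-p∣ m n o p = begin
  ∣ m + n - o + p ∣                     ≤⟨ ∣-∣-triangle (m + n) (o + n) (o + p) ⟩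
  ∣ m + n - o + n ∣ + ∣ o + n - o + p ∣ ≡⟨ cong₂ _+_ first (∣m+n-m+o∣≡∣n-o∣ o n p) ⟩
  ∣ m - o ∣ + ∣ n - p ∣                 ∎
  where
  open ≤-Reasoning
  first : ∣ m + n - o + n ∣ ≡ ∣ m - o ∣
  first rewrite +-comm m n | +-comm o n = ∣m+n-m+o∣≡∣n-o∣ n m o

offset : ℕ → ℕ → ℕ → ℕ
offset E n x = x + E ∸ n

module _ {E n x : ℕ} (x≈n : ∣ x - n ∣ ≤ E) where

  offset-< : offset E n x < suc (2 * E)
  offset-< = s≤s (m≤n+o⇒m∸n≤o (x + E) n (begin
    x + E               ≤⟨ +-monoˡ-≤ E (≤-trans (m≤n+∣m-n∣ x n) (+-monoʳ-≤ n x≈n)) ⟩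
    n + E + E           ≡⟨ +-assoc n E E ⟩
    n + (E + E)         ≡⟨ cong (λ e → n + (E + e)) (sym (+-identityʳ E)) ⟩
    n + 2 * E           ∎))
    where open ≤-Reasoning

  offset-inverse : n + offset E n x ∸ E ≡ x
  offset-inverse = begin
    n + (x + E ∸ n) ∸ E ≡⟨ cong (_∸ E) (m+[n∸m]≡n (≤-trans (m≤n+∣n-m∣ n x) (+-monoʳ-≤ x x≈n))) ⟩
    x + E ∸ E           ≡⟨ m+n∸n≡m x E ⟩
    x                   ∎
    where open ≡-Reasoning

m*n≤o⇒m≤o/n : ∀ {m n o} .{{_ : NonZero n}} → m * n ≤ o → m ≤ o / n
m*n≤o⇒m≤o/n {m} {n} mn≤o = subst (_≤ _) (m*n/n≡m m n) (/-monoˡ-≤ n mn≤o)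

m*n<o*p⇒m*[n/p]<o : ∀ m n o p .{{_ : NonZero p}} → m * n < o * p → m * (n / p) < o
m*n<o*p⇒m*[n/p]<o m n o p mn<op = *-cancelʳ-< p _ _ (begin-strict
  m * (n / p) * p   ≡⟨ *-assoc m (n / p) p ⟩
  m * (n / p * p)   ≤⟨ *-monoʳ-≤ m (m/n*n≤m n p) ⟩
  m * n             <⟨ mn<op ⟩
  o * p             ∎)
  where open ≤-Reasoning

sumUpTo : (ℕ → ℕ) → ℕ → ℕ
sumUpTo g zero    = g zero
sumUpTo g (suc n) = sumUpTo g n + g (suc n)

≤-sumUpTo : ∀ g {i n} → i ≤ n → g i ≤ sumUpTo g n
≤-sumUpTo g {zero}  {zero}  _     = ≤-refl
≤-sumUpTo g {i}     {suc n} i≤1+n with m≤n⇒m<n∨m≡n i≤1+n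
... | inj₁ i<1+n = ≤-trans (≤-sumUpTo g (s≤s⁻¹ i<1+n)) (m≤m+n _ _)
... | inj₂ refl  = m≤n+m _ _

Unique-map⁺-on : ∀ {A B : Set} {P : A → Set} {f : A → B} {xs} →
                 (∀ {x y} → P x → P y → f x ≡ f y → x ≡ y) →
                 All P xs → Unique xs → Unique (map f xs)
Unique-map⁺-on inj []         []             = []
Unique-map⁺-on inj (px ∷ pxs) (x∉xs ∷ uxs) =
  All.map⁺ (All.zipWith (λ (py , x≢y) → x≢y ∘ inj px py) (pxs , x∉xs)) ∷ Unique-map⁺-on inj pxs uxs

length-filter+length-filter-∁ : ∀ {A : Set} {P : A → Set} (P? : Decidable P) xs →
                                length (filter P? xs) + length (filter (∁? P?) xs) ≡ length xs
length-filter+length-filter-∁ P? []       = refl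
length-filter+length-filter-∁ P? (x ∷ xs) with P? x
... | yes _ = cong suc (length-filter+length-filter-∁ P? xs)
... | no  _ = trans (+-suc _ _) (cong suc (length-filter+length-filter-∁ P? xs))

module _ {A : Set} (κ : A → ℕ) where

  box : ℕ → List A → List A
  box v = filter (λ x → κ x ≟ v)

  pigeonhole : ∀ m R xs → All (λ x → κ x < R) xs → R * m < length xs → ∃ λ v → m < length (box v xs)
  pigeonhole m zero    (_ ∷ _) (() ∷ _) _
  pigeonhole m (suc R) xs      κ<1+R    long with m <? length (box R xs)
  ... | yes m<∣box∣ = R , m<∣box∣
  ... | no  m≮∣box∣ =
    map₂ (λ m<∣box∣ → <-≤-trans m<∣box∣ (box-rest≤box _)) (pigeonhole m R rest κ<R rest-long)
    where
    rest = filter (∁? (λ x → κ x ≟ R)) xs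
    κ<R : All (λ x → κ x < R) rest
    κ<R = All.zipWith (λ (κx<1+R , κx≢R) → ≤∧≢⇒< (s≤s⁻¹ κx<1+R) κx≢R)
            (All.filter⁺ _ κ<1+R , All.all-filter _ xs)
    rest-long : R * m < length rest
    rest-long = +-cancelˡ-< m _ _ (begin-strict
      m + R * m                         <⟨ long ⟩
      length xs                         ≡⟨ sym (length-filter+length-filter-∁ _ xs) ⟩
      length (box R xs) + length rest   ≤⟨ +-monoˡ-≤ _ (≮⇒≥ m≮∣box∣) ⟩
      m + length rest                   ∎)
      where open ≤-Reasoning
    box-rest≤box : ∀ v → length (box v rest) ≤ length (box v xs)
    box-rest≤box v = length-mono-≤ (Sublist.filter⁺ _ _ (λ { refl κx≡v → κx≡v }) (filter-⊆ _ xs))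

num den : ℚ → ℕ
num q = ℤ.∣ ↥ q ∣
den q = ↧ₙ q

num-pos : ∀ q → Positive q → 1 ≤ num q
num-pos (mkℚ +[1+ _ ] _ _) _ = s≤s z≤n

private
  toℚᵘ-ℕtoℚ : ∀ a → toℚᵘ (ℕtoℚ a) ≃ᵘ mkℚᵘ (ℤ.+ a) 0
  toℚᵘ-ℕtoℚ a = toℚᵘ-fromℚᵘ (mkℚᵘ (ℤ.+ a) 0)

  ℚᵘ-≤⇒*≤* : ∀ {a a' c c'} → mkℚᵘ (ℤ.+ a) a' ≤ᵘ mkℚᵘ (ℤ.+ c) c' → a * suc c' ≤ c * suc a'
  ℚᵘ-≤⇒*≤* {a} {a'} {c} {c'} (*≤* h) =
    drop‿+≤+ (subst₂ ℤ._≤_ (sym (pos-* a (suc c'))) (sym (pos-* c (suc a'))) h)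

  ℚᵘ-<⇒*<* : ∀ {a a' c c'} → mkℚᵘ (ℤ.+ a) a' <ᵘ mkℚᵘ (ℤ.+ c) c' → a * suc c' < c * suc a'
  ℚᵘ-<⇒*<* {a} {a'} {c} {c'} (*<* h) =
    drop‿+<+ (subst₂ ℤ._<_ (sym (pos-* a (suc c'))) (sym (pos-* c (suc a'))) h)

ℕtoℚ-≤⇒*den≤num : ∀ a q → Positive q → ℕtoℚ a ≤ℚ q → a * den q ≤ num q
ℕtoℚ-≤⇒*den≤num a (mkℚ +[1+ n ] d _) _ a≤q =
  subst (a * suc d ≤_) (*-identityʳ (suc n))
    (ℚᵘ-≤⇒*≤* (≤-respˡ-≃ (toℚᵘ-ℕtoℚ a) (toℚᵘ-mono-≤ a≤q)))

ℕtoℚ-<-÷⇒*num<*den : ∀ a c q (pos : Positive q) →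
                     ℕtoℚ a <ℚ _÷_ (ℕtoℚ c) q {{pos⇒nonZero q {{pos}}}} → a * num q < c * den q
ℕtoℚ-<-÷⇒*num<*den a c q@(mkℚ +[1+ n ] d _) _ a<c÷q =
  subst (a * suc n <_) (*-identityʳ (c * suc d))
    (ℚᵘ-<⇒*<* (<-respʳ-≃ c÷q≃ (<-respˡ-≃ (toℚᵘ-ℕtoℚ a) (toℚᵘ-mono-< a<c÷q))))
  where
  c÷q≃ : toℚᵘ (ℕtoℚ c ÷ q) ≃ᵘ mkℚᵘ (ℤ.+ (c * suc d)) n
  c÷q≃ = ≃-trans (toℚᵘ-homo-* (ℕtoℚ c) _) (≃-trans (*-congʳ (toℚᵘ-ℕtoℚ c))
           (*≡* (cong₂ ℤ._*_ (sym (pos-* c (suc d))) (cong (λ z → ℤ.+ suc z) (sym (+-identityʳ n))))))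

IsSquareRep : ℕ → ℕ → ℕ × ℕ → Set
IsSquareRep k n (i , j) = (1 ≤ i × i ≤ k) × (1 ≤ j × j ≤ k) × i * i + j * j ≡ n

SquareReps : ℕ → ℕ → ℕ → Set
SquareReps k n ℓ = Σ (List (ℕ × ℕ)) λ L → Unique L × ℓ ≤ length L × All (IsSquareRep k n) L

SquareReps-mono : ∀ {k k' n ℓ} → k ≤ k' → SquareReps k n ℓ → SquareReps k' n ℓ
SquareReps-mono k≤k' (L , unique , long , reps) =
  L , unique , long ,
  All.map (λ ((1≤i , i≤k) , (1≤j , j≤k) , sum) →
             (1≤i , ≤-trans i≤k k≤k') , (1≤j , ≤-trans j≤k k≤k') , sum) reps

findRoot : List ℕ → ℕ → ℕ
findRoot []       x = 0
findRoot (j ∷ js) x = if suc j * suc j ≡ᵇ x then suc j else findRoot js x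

findRoot-correct : ∀ {k} js x → All (_< k) js → T (any (λ j → suc j * suc j ≡ᵇ x) js) →
                   (1 ≤ findRoot js x × findRoot js x ≤ k) × findRoot js x * findRoot js x ≡ x
findRoot-correct (j ∷ js) x (j<k ∷ js<k) found with suc j * suc j ≡ᵇ x in eq
... | true  = (s≤s z≤n , j<k) , ≡ᵇ⇒≡ _ _ (subst T (sym eq) _)
... | false = findRoot-correct js x js<k found

u-attained : ∀ k → ∃ λ n → u k ≤ r (squaresUpTo k) n
u-attained k with foldr-selective ⊔-sel 0 (map (r (squaresUpTo k)) (upTo (suc (2 * (k * k)))))
... | inj₁ u≡0 = 0 , subst (_≤ r (squaresUpTo k) 0) (sym u≡0) z≤n
... | inj₂ u∈  with n , _ , u≡r ← ∈-map⁻ _ u∈ = n , ≤-reflexive u≡r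

u-squareReps : ∀ k → ∃ λ n → SquareReps k n (u k)
u-squareReps k with n , u≤r ← u-attained k =
  n , map rootPair xs , Unique-map⁺-on same-root props (Unique.filter⁺ (T? ∘ both) (Unique.upTo⁺ (suc n))) ,
  ≤-trans u≤r (≤-reflexive (sym (length-map rootPair xs))) , All.map⁺ (All.map rep props)
  where
  S = squaresUpTo k
  both : ℕ → Bool
  both x = S x ∧ S (n ∸ x)
  xs = filterᵇ both (upTo (suc n))
  root : ℕ → ℕ
  root = findRoot (upTo k)
  rootPair : ℕ → ℕ × ℕ
  rootPair x = root x , root (n ∸ x)
  root-correct : ∀ {x} → T (S x) → (1 ≤ root x × root x ≤ k) × root x * root x ≡ x
  root-correct {x} = findRoot-correct (upTo k) x (All.all-upTo k)
  Admissible : ℕ → Set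
  Admissible x = x ≤ n × T (S x) × T (S (n ∸ x))
  props : All Admissible xs
  props = All.zipWith (λ (x<1+n , Sx∧Sn∸x) → s≤s⁻¹ x<1+n , Equivalence.to T-∧ Sx∧Sn∸x)
            (All.filter⁺ (T? ∘ both) (All.all-upTo (suc n)) , All.all-filter (T? ∘ both) (upTo (suc n)))
  rep : ∀ {x} → Admissible x → IsSquareRep k n (rootPair x)
  rep {x} (x≤n , Sx , Sn∸x) with i-range , i²≡x ← root-correct Sx | j-range , j²≡n∸x ← root-correct Sn∸x =
    i-range , j-range , trans (cong₂ _+_ i²≡x j²≡n∸x) (m+[n∸m]≡n x≤n)
  same-root : ∀ {x y} → Admissible x → Admissible y → rootPair x ≡ rootPair y → x ≡ y
  same-root (_ , Sx , _) (_ , Sy , _) eq =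
    trans (sym (proj₂ (root-correct Sx))) (trans (cong (λ i → i * i) (cong proj₁ eq)) (proj₂ (root-correct Sy)))

oddLeg evenLeg hypotenuse : ℕ → ℕ
oddLeg j = 1 + 2 * j
evenLeg j = 2 * j + 2 * (j * j)
hypotenuse j = 1 + evenLeg j

pythagoras : ∀ j → oddLeg j * oddLeg j + evenLeg j * evenLeg j ≡ hypotenuse j * hypotenuse j
pythagoras = identity
  where
  identity : ∀ j → (1 + 2 * j) * (1 + 2 * j) + (2 * j + 2 * (j * j)) * (2 * j + 2 * (j * j))
                 ≡ (1 + (2 * j + 2 * (j * j))) * (1 + (2 * j + 2 * (j * j)))
  identity = solve-∀

hypotenuse-increasing : ∀ j → hypotenuse j < hypotenuse (suc j)
hypotenuse-increasing j = s≤s (+-mono-<-≤ (*-monoʳ-< 2 (n<1+n j)) (*-monoʳ-≤ 2 (*-mono-≤ (n≤1+n j) (n≤1+n j))))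

-- Rescaled by their cofactors, the triples j = 1, …, n all get this common hypotenuse.
hypotenuseProduct : ℕ → ℕ
hypotenuseProduct n = product (applyUpTo (hypotenuse ∘ suc) n)

hypotenuseProduct-nonZero : ∀ n → NonZero (hypotenuseProduct n)
hypotenuseProduct-nonZero n = product≢0 (All.applyUpTo⁺₂ (hypotenuse ∘ suc) n (λ _ → _))

cofactor : ℕ → ℕ → ℕ
cofactor n i = hypotenuseProduct n / hypotenuse (suc i)

pythagoreanPair : ℕ → ℕ → ℕ × ℕ
pythagoreanPair n i = oddLeg (suc i) * cofactor n i , evenLeg (suc i) * cofactor n i

module _ {n i : ℕ} (i<n : i < n) where

  private
    D = hypotenuseProduct n
    c = cofactor n i
    h = hypotenuse (suc i)

    h∣D : h ∣ D
    h∣D = ∈⇒∣product (∈-applyUpTo⁺ (hypotenuse ∘ suc) i<n)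

  cofactor-*-hypotenuse : c * h ≡ D
  cofactor-*-hypotenuse = m/n*n≡m h∣D

  cofactor-pos : 1 ≤ c
  cofactor-pos = m≥n⇒m/n>0 (∣⇒≤ {{hypotenuseProduct-nonZero n}} h∣D)

  -- hypotenuse = 1 + evenLeg, so the left side is hypotenuse * cofactor by definition.
  cofactor-+-evenLeg : c + evenLeg (suc i) * c ≡ D
  cofactor-+-evenLeg = trans (*-comm h c) cofactor-*-hypotenuse

  private
    leg-*-cofactor-≤ : ∀ {leg} → leg ≤ h → leg * c ≤ D
    leg-*-cofactor-≤ leg≤h = ≤-trans (*-monoˡ-≤ c leg≤h) (≤-reflexive cofactor-+-evenLeg)

  pythagoreanPair-sumOfSquares : let (x , y) = pythagoreanPair n i in x * x + y * y ≡ D * D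
  pythagoreanPair-sumOfSquares = begin
    a * c * (a * c) + b * c * (b * c) ≡⟨ factor a b c ⟩
    (a * a + b * b) * (c * c)         ≡⟨ cong (_* (c * c)) (pythagoras (suc i)) ⟩
    h * h * (c * c)                   ≡⟨ regroup h c ⟩
    c * h * (c * h)                   ≡⟨ cong₂ _*_ cofactor-*-hypotenuse cofactor-*-hypotenuse ⟩
    D * D                             ∎
    where
    open ≡-Reasoning
    a = oddLeg (suc i)
    b = evenLeg (suc i)
    factor : ∀ a b c → a * c * (a * c) + b * c * (b * c) ≡ (a * a + b * b) * (c * c)
    factor = solve-∀
    regroup : ∀ h c → h * h * (c * c) ≡ c * h * (c * h)
    regroup = solve-∀

  pythagoreanPair-isSquareRep : IsSquareRep D (D * D) (pythagoreanPair n i)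
  pythagoreanPair-isSquareRep =
    (*-mono-≤ {1} {oddLeg (suc i)} (s≤s z≤n) cofactor-pos , leg-*-cofactor-≤ (s≤s (m≤m+n (2 * suc i) _))) ,
    (*-mono-≤ {1} {evenLeg (suc i)} (s≤s z≤n) cofactor-pos , leg-*-cofactor-≤ (n≤1+n _)) ,
    pythagoreanPair-sumOfSquares

pythagoreanPair-injective : ∀ {n i i'} → i < n → i' < n → pythagoreanPair n i ≡ pythagoreanPair n i' → i ≡ i'
pythagoreanPair-injective {n} {i} {i'} i<n i'<n eq =
  suc-injective (increasing⇒injective (λ j _ → hypotenuse-increasing j) (s≤s z≤n) (s≤s z≤n) same-hypotenuse)
  where
  same-cofactor : cofactor n i ≡ cofactor n i'
  same-cofactor = +-cancelʳ-≡ _ _ _ (begin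
    cofactor n i + evenLeg (suc i) * cofactor n i    ≡⟨ cofactor-+-evenLeg i<n ⟩
    hypotenuseProduct n                              ≡⟨ cofactor-+-evenLeg i'<n ⟨
    cofactor n i' + evenLeg (suc i') * cofactor n i' ≡⟨ cong (cofactor n i' +_) (cong proj₂ eq) ⟨
    cofactor n i' + evenLeg (suc i) * cofactor n i   ∎)
    where open ≡-Reasoning
  same-hypotenuse : hypotenuse (suc i) ≡ hypotenuse (suc i')
  same-hypotenuse = *-cancelˡ-≡ _ _ (cofactor n i) {{>-nonZero (cofactor-pos i<n)}} (begin
    cofactor n i * hypotenuse (suc i)  ≡⟨ cofactor-*-hypotenuse i<n ⟩
    hypotenuseProduct n                ≡⟨ cofactor-*-hypotenuse i'<n ⟨
    cofactor n i' * hypotenuse (suc i') ≡⟨ cong (_* hypotenuse (suc i')) same-cofactor ⟨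
    cofactor n i * hypotenuse (suc i')  ∎)
    where open ≡-Reasoning

pythagoreanReps : ∀ n → SquareReps (hypotenuseProduct n) (hypotenuseProduct n * hypotenuseProduct n) n
pythagoreanReps n =
  applyUpTo (pythagoreanPair n) n ,
  AllPairs.applyUpTo⁺₁ (pythagoreanPair n) n
    (λ i<i' i'<n → <⇒≢ i<i' ∘ pythagoreanPair-injective (<-trans i<i' i'<n) i'<n) ,
  ≤-reflexive (sym (length-applyUpTo (pythagoreanPair n) n)) ,
  All.applyUpTo⁺₁ (pythagoreanPair n) n pythagoreanPair-isSquareRep

module _ (b : ℕ → ℕ) (b-increasing : ∀ i → 1 ≤ i → b i < b (suc i)) where

  perturbedReps : ∀ {k F n ℓ} m → (∀ i → 1 ≤ i → i ≤ k → ∣ b i - i * i ∣ ≤ F) →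
                  SquareReps k n ℓ → suc (4 * F) * m < ℓ → ∃ λ n' → AtLeastReps (EnumSet b) n' m
  perturbedReps {k} {F} {n} m b≈square (L , unique , ℓ≤∣L∣ , reps) long =
    repsFromBox (pigeonhole κ m (suc (2 * E)) L (All.map κ< reps) long')
    where
    E = 2 * F
    image : ℕ × ℕ → ℕ × ℕ
    image (i , j) = b i , b j
    κ : ℕ × ℕ → ℕ
    κ (i , j) = offset E n (b i + b j)

    sum≈n : ∀ {i j} → IsSquareRep k n (i , j) → ∣ b i + b j - n ∣ ≤ E
    sum≈n {i} {j} ((1≤i , i≤k) , (1≤j , j≤k) , refl) = begin
      ∣ b i + b j - i * i + j * j ∣      ≤⟨ ∣m+n-o+p∣≤∣m-o∣+∣n-p∣ (b i) (b j) (i * i) (j * j) ⟩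
      ∣ b i - i * i ∣ + ∣ b j - j * j ∣  ≤⟨ +-mono-≤ (b≈square i 1≤i i≤k) (b≈square j 1≤j j≤k) ⟩
      F + F                              ≡⟨ cong (F +_) (+-identityʳ F) ⟨
      2 * F                              ∎
      where open ≤-Reasoning

    κ< : ∀ {p} → IsSquareRep k n p → κ p < suc (2 * E)
    κ< {i , j} rep = offset-< {x = b i + b j} (sum≈n rep)

    long' : suc (2 * E) * m < length L
    long' = subst (λ t → suc t * m < length L) (*-assoc 2 2 F) (<-≤-trans long ℓ≤∣L∣)

    repsFromBox : (∃ λ v → m < length (box κ v L)) → ∃ λ n' → AtLeastReps (EnumSet b) n' m
    repsFromBox (v , m<∣box∣) =
      n + v ∸ E , take m images ,
      Unique.take⁺ m (Unique-map⁺-on image-injective inBox (Unique.filter⁺ _ unique)) ,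
      trans (length-take m images)
            (m≤n⇒m⊓n≡m (<⇒≤ (<-≤-trans m<∣box∣ (≤-reflexive (sym (length-map image (box κ v L))))))) ,
      All.take⁺ m (All.map⁺ (All.map (λ { {i , j} → isRep }) inBox))
      where
      images = map image (box κ v L)
      InBox : ℕ × ℕ → Set
      InBox p = IsSquareRep k n p × κ p ≡ v
      inBox : All InBox (box κ v L)
      inBox = All.zip (All.filter⁺ _ reps , All.all-filter _ L)
      image-injective : ∀ {p q} → InBox p → InBox q → image p ≡ image q → p ≡ q
      image-injective (((1≤i , _) , (1≤j , _) , _) , _) (((1≤i' , _) , (1≤j' , _) , _) , _) eq =
        cong₂ _,_ (increasing⇒injective b-increasing 1≤i 1≤i' (cong proj₁ eq))
                  (increasing⇒injective b-increasing 1≤j 1≤j' (cong proj₂ eq))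
      isRep : ∀ {i j} → InBox (i , j) → EnumSet b (b i) × EnumSet b (b j) × b i + b j ≡ n + v ∸ E
      isRep {i} {j} (rep@((1≤i , _) , (1≤j , _) , _) , refl) =
        (i , 1≤i , refl) , (j , 1≤j , refl) , sym (offset-inverse {x = b i + b j} (sum≈n rep))

  closeToSquares⇒reps : ∀ m {k F} → (∀ i → 1 ≤ i → i ≤ k → ∣ b i - i * i ∣ ≤ F) →
                        hypotenuseProduct (suc m) ≤ k → 5 * m * F < u k → ∃ λ n → AtLeastReps (EnumSet b) n m
  closeToSquares⇒reps m {F = zero} b≈square D≤k _ =
    perturbedReps m b≈square (SquareReps-mono D≤k (pythagoreanReps (suc m))) (s≤s (≤-reflexive (+-identityʳ m)))
  closeToSquares⇒reps m {k} {F@(suc F-1)} b≈square _ 5mF<u with n , reps ← u-squareReps k =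
    perturbedReps m b≈square reps (begin-strict
      suc (4 * F) * m  ≤⟨ *-monoˡ-≤ m (s≤s (m≤n+m (4 * F) F-1)) ⟩
      5 * F * m        ≡⟨ reorder F m ⟩
      5 * m * F        <⟨ 5mF<u ⟩
      u k              ∎)
    where
    open ≤-Reasoning
    reorder : ∀ F m → 5 * F * m ≡ 5 * m * F
    reorder = solve-∀

largeIndex : (f : ℕ → ℚ) (fpos : ∀ k → 1 ≤ k → Positive (f k)) →
             (∀ (M : ℚ) → ∃ λ k → Σ (1 ≤ k) λ h → M <ℚ ratio f k (fpos k h)) →
             ∀ K C → ∃ λ k → 1 ≤ k × K < k × C * num (f k) < u k * den (f k)
largeIndex f fpos unbounded K C = pick (unbounded (ℕtoℚ N))
  where
  -- For k ≤ K, u k / f k ≤ u k * den (f k) ≤ N, so exceeding N forces K < k.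
  N = C + sumUpTo (λ k → u k * den (f k)) K
  pick : (∃ λ k → Σ (1 ≤ k) λ h → ℕtoℚ N <ℚ ratio f k (fpos k h)) →
         ∃ λ k → 1 ≤ k × K < k × C * num (f k) < u k * den (f k)
  pick (k , 1≤k , N<ratio) = k , 1≤k , K<k , ≤-<-trans (*-monoˡ-≤ (num (f k)) (m≤m+n C _)) N*num<u*den
    where
    N*num<u*den : N * num (f k) < u k * den (f k)
    N*num<u*den = ℕtoℚ-<-÷⇒*num<*den N (u k) (f k) (fpos k 1≤k) N<ratio
    K<k : K < k
    K<k = ≰⇒> λ k≤K → <⇒≱ N*num<u*den (begin
      u k * den (f k)  ≤⟨ ≤-sumUpTo (λ k → u k * den (f k)) k≤K ⟩
      sumUpTo _ K      ≤⟨ m≤n+m _ C ⟩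
      N                ≤⟨ m≤m*n N (num (f k)) {{>-nonZero (num-pos (f k) (fpos k 1≤k))}} ⟩
      N * num (f k)    ∎)
      where open ≤-Reasoning

mainTheorem3 : (f : ℕ → ℚ) (fpos : ∀ k → 1 ≤ k → Positive (f k)) →
               (∀ (M : ℚ) → ∃ λ k → Σ (1 ≤ k) λ h → M <ℚ ratio f k (fpos k h)) →
               (b : ℕ → ℕ) → (∀ i → 1 ≤ i → b i < b (suc i)) →
               (∀ k → 1 ≤ k → ∀ n → 1 ≤ n → n ≤ k → ℕtoℚ ∣ b n - n * n ∣ ≤ℚ f k) →
               UpperClass (EnumSet b)
mainTheorem3 f fpos unbounded b b-increasing b≈square m =
  conclude (largeIndex f fpos unbounded D (5 * m))
  where
  D = hypotenuseProduct (suc m)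
  conclude : (∃ λ k → 1 ≤ k × D < k × 5 * m * num (f k) < u k * den (f k)) →
             ∃ λ n → AtLeastReps (EnumSet b) n m
  conclude (k , 1≤k , D<k , 5m*num<u*den) =
    closeToSquares⇒reps b b-increasing m b≈⌊f⌋ (<⇒≤ D<k)
      (m*n<o*p⇒m*[n/p]<o (5 * m) (num (f k)) (u k) (den (f k)) 5m*num<u*den)
    where
    b≈⌊f⌋ : ∀ i → 1 ≤ i → i ≤ k → ∣ b i - i * i ∣ ≤ num (f k) / den (f k)
    b≈⌊f⌋ i 1≤i i≤k = m*n≤o⇒m≤o/n
      (ℕtoℚ-≤⇒*den≤num ∣ b i - i * i ∣ (f k) (fpos k 1≤k) (b≈square k 1≤k i 1≤i i≤k))
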